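{- Let $D$ be a finite set and $R\subseteq D^r$ a relation that has a Mal'tsev embedding, possibly into an infinite domain. Then for every $k\ge2$, every partial function in $I_D(U_k^{k-1})$ is a partial polymorphism of $R$.
   Context: $R$ has a Mal'tsev embedding if there are a set $E$ (possibly infinite), an injective $\sigma:D\to E$, a relation $Q\subseteq E^r$ with $Q\cap\sigma(D)^r=\sigma(R)$, and $\varphi:E^3\to E$ with $\varphi(a,a,b)=\varphi(b,a,a)=b$ for all $a,b$, such that $\varphi$ applied componentwise to any three tuples of $Q$ yields a tuple of $Q$. An $n$-ary polymorphism pattern over variables $V$ is a set of pairs $((v_1,\dots,v_n),v)$; $I_D(P)$ is the set of partial functions $f$ from $D^n$ to $D$ such that for each $((v_1,\dots,v_n),v)\in P$ and each $g:\{v_1,\dots,v_n,v\}\to D$, $(g(v_1),\dots,g(v_n))$ is in the domain of $f$ and, if $v\in\{v_1,\dots,v_n\}$, $f(g(v_1),\dots,g(v_n))=g(v)$; $f$ is undefined elsewhere. $f$ is a partial polymorphism of $R$ if for all $t^{(1)},\dots,t^{(n)}\in R$ whose columns all lie in the domain of $f$, the tuple of values of $f$ on the columns lies in $R$. $U_k$ has arity $2^k-1$, variables $\{x,y\}$, and consists of $P_i=(X_i,y)$, $i\in[k]$, where position $j$ of $X_i$ is $x$ if the $i$-th bit of $j$ is $1$ and $y$ otherwise. For a pattern with pairs $(X_1,y_1),\dots,(X_m,y_m)$, the power $P^c$ consists, for each $S=\{i_1<\dots<i_c\}\subseteq[m]$, of $(X_S,y_S)$ with $X_S[p]=(X_{i_1}[p],\dots,X_{i_c}[p])$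 and $y_S=(y_{i_1},\dots,y_{i_c})$. -}

module Defs where

open import Data.Nat using (ℕ; zero; suc; _^_; _∸_; _/_; _%_)
open import Data.Bool using (Bool; true; false; if_then_else_)
open import Data.Fin using (Fin; toℕ)
open import Data.Vec using (Vec; []; _∷_; map; lookup; tabulate; transpose)
open import Data.Vec.Relation.Unary.All using (All)
open import Data.Vec.Membership.Propositional as VecMem using ()
open import Data.List using (List; []; _∷_; _++_; upTo) renaming (map to lmap)
open import Data.List.Membership.Propositional using (_∈_)
open import Data.Maybe using (Maybe; just; nothing)
open import Data.Product using (Σ; ∃; _×_; _,_; proj₁; proj₂)
open import Relation.Binary.PropositionalEquality using (_≡_)
open import Relation.Nullary using (¬_)
open import Function.Bundles using (_⇔_)
open import Function.Definitions using (Injective)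

open import Function.Bundles using (_↔_) public

IsFinite : Set → Set
IsFinite D = ∃ λ m → Fin m ↔ D

record MaltsevEmbedding {D : Set} {r : ℕ} (R : Vec D r → Set) : Set₁ where
  field
    E      : Set
    σ      : D → E
    σ-inj  : Injective _≡_ _≡_ σ
    Q      : Vec E r → Set
    Q∩σD   : (t : Vec D r) → Q (map σ t) ⇔ R t
    φ      : E → E → E → E
    φ-left  : ∀ a b → φ a a b ≡ b
    φ-right : ∀ a b → φ b a a ≡ b
    φ-pres : ∀ (a b c : Vec E r) → Q a → Q b → Q c →
             Q (tabulate λ j → φ (lookup a j) (lookup b j) (lookup c j))

Pattern : ℕ → Set → Set
Pattern n V = List (Vec V n × V)

PartialFun : Set → ℕ → Set
PartialFun D n = Vec D n → Maybe D

InPatternDom : {D V : Set} {n : ℕ} → Pattern n V → Vec D n → Set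
InPatternDom {D} {V} P t =
  Σ (Vec V _ × V) λ p → (p ∈ P) × Σ (V → D) λ g → map g (proj₁ p) ≡ t

InI : {D V : Set} {n : ℕ} → Pattern n V → PartialFun D n → Set
InI {D} {V} P f =
  ((t : Vec D _) → InPatternDom P t → ∃ λ d → f t ≡ just d)
  × ((t : Vec D _) → ¬ InPatternDom P t → f t ≡ nothing)
  × ((p : Vec V _ × V) → p ∈ P → (g : V → D) → proj₂ p VecMem.∈ proj₁ p →
       f (map g (proj₁ p)) ≡ just (g (proj₂ p)))

IsPartialPolymorphism : {D : Set} {r n : ℕ} → (Vec D r → Set) → PartialFun D n → Set
IsPartialPolymorphism {D} {r} {n} R f =
  (ts : Vec (Vec D r) n) → All R ts →
  (vals : Vec D r) →
  ((j : Fin r) → f (map (λ t → lookup t j) ts) ≡ just (lookup vals j)) →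
  R vals

data XY : Set where
  x y : XY

bit : ℕ → ℕ → Bool
bit zero    j = Data.Nat._≡ᵇ_ (j % 2) 1
bit (suc i) j = bit i (j / 2)

-- U_k : arity 2^k - 1; pair P_i (i = 1..k, encoded as i-1 = 0..k-1),
-- position j ∈ {1,…,2^k-1} (encoded as p : Fin (2^k-1), j = p+1)
U : (k : ℕ) → Pattern (2 ^ k ∸ 1) XY
U k = lmap (λ i → (tabulate (λ p → if bit i (suc (toℕ p)) then x else y) , y)) (upTo k)

-- order-preserving c-element sublists (subsets {i₁<…<i_c})
choose : {A : Set} → (c : ℕ) → List A → List (Vec A c)
choose zero    _        = [] ∷ []
choose (suc c) []       = []
choose (suc c) (a ∷ as) = lmap (a ∷_) (choose c as) ++ choose (suc c) as

power : {n : ℕ} {V : Set} → (c : ℕ) → Pattern n V → Pattern n (Vec V c)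
power c P = lmap (λ S → (transpose (map proj₁ S) , map proj₂ S)) (choose c P)

-- Index the 2^k − 1 arguments of a function in I_D(U_k^(k−1)) by the nonzero points of the
-- cube {0,1}^k, a point v standing for the position whose binary digits are v. A Mal'tsev
-- operation φ yields a term over these points which equals h(0) for every h : {0,1}^k → E
-- that does not depend on some coordinate. Each pair (X_S, y_S) of U_k^(k−1) omits some
-- index i ∉ S, so, putting y_S at the origin, X_S does not depend on bit i; the same then
-- holds for every column of tuples of R on which f is defined, and the term evaluates that
-- column to the value of f. Applied to the images of the tuples in Q, the term therefore
-- returns the image of the output tuple, which lies in Q and hence in R.
module Submission where

open import Defs
open import Data.Bool using (Bool; true; false; if_then_else_)
open import Data.Empty using (⊥-elim)
open import Data.Fin using (Fin; toℕ; fromℕ<) renaming (zero to fzero; suc to fsuc)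
open import Data.Fin.Properties using (toℕ-fromℕ<; inj⇒≟; all?)
open import Data.List using (List; []; _∷_; _++_; upTo; length) renaming (map to lmap)
open import Data.List.Properties using (map-++; length-upTo) renaming (map-∘ to lmap-∘)
open import Data.List.Membership.Propositional using (_∈_; find; lose)
open import Data.List.Membership.Propositional.Properties using (∈-map⁻; ∈-++⁻; ∈-upTo⁻)
open import Data.List.Relation.Unary.Any using (here; there; any?)
open import Data.List.Relation.Unary.AllPairs using ([]; _∷_)
import Data.List.Relation.Unary.All as List
open import Data.List.Relation.Unary.Unique.Propositional using (Unique)
open import Data.List.Relation.Unary.Unique.Propositional.Properties using (upTo⁺)
open import Data.Maybe using (just; nothing)
open import Data.Maybe.Properties using (just-injective)
open import Data.Nat using (ℕ; zero; suc; _+_; _*_; _∸_; _^_; _/_; _%_; _≡ᵇ_; _≤_; _<_; z≤n; s≤s)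
open import Data.Nat.DivMod using (m*n/n≡m; m*n%n≡0; [m+kn]%n≡m%n; +-distrib-/)
open import Data.Nat.Properties
  using ( ≤-refl; n<1+n; n≤1+n; *-monoˡ-≤; *-monoʳ-≤; *-comm; m^n>0; m*n≡0⇒m≡0∨n≡0
        ; module ≤-Reasoning)
open import Data.Product using (∃; _×_; _,_; proj₁; proj₂)
open import Data.Sum using (inj₁; inj₂)
open import Data.Vec using (Vec; []; _∷_; map; lookup; tabulate; transpose; replicate; tail; _⊛_)
open import Data.Vec.Properties
  using ( lookup-map; lookup-⊛; lookup-replicate; lookup∘tabulate; tabulate∘lookup; tabulate-∘
        ; tabulate-cong; map-cong; map-∘; ≡-dec)
open import Data.Vec.Relation.Unary.All using (All; []; _∷_)
import Data.Vec.Relation.Unary.All as All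
open import Data.Vec.Relation.Unary.All.Properties using (lookup⁺)
open import Data.Vec.Relation.Binary.Pointwise.Extensional using (ext; Pointwise-≡⇒≡)
import Data.Vec.Membership.Propositional as Vec
open import Data.Vec.Membership.Propositional.Properties using (∈-lookup)
open import Function using (_∘_)
open import Function.Bundles using (Equivalence)
open import Function.Properties.Inverse using (↔-sym; ↔⇒↣)
open import Relation.Binary.Definitions using (DecidableEquality)
open import Relation.Binary.PropositionalEquality
open import Relation.Nullary using (Dec; yes; no)
open import Relation.Nullary.Decidable using (_→-dec_; decidable-stable; map′)
open import Relation.Unary using (Decidable)

private
  variable
    A B V : Set
    c k n : ℕ

-- Binary positions

bitAt : Vec Bool k → ℕ → Bool
bitAt []      _       = false
bitAt (b ∷ v) zero    = b
bitAt (b ∷ v) (suc i) = bitAt v i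

bitAt-replicate : ∀ k i → bitAt (replicate k false) i ≡ false
bitAt-replicate zero    i       = refl
bitAt-replicate (suc k) zero    = refl
bitAt-replicate (suc k) (suc i) = bitAt-replicate k i

-- least significant bit first, matching Defs.bit
fromBits : Vec Bool k → ℕ
fromBits []          = 0
fromBits (false ∷ v) = fromBits v * 2
fromBits (true ∷ v)  = suc (fromBits v * 2)

bit-fromBits : ∀ (v : Vec Bool k) i → bit i (fromBits v) ≡ bitAt v i
bit-fromBits []          zero    = refl
bit-fromBits []          (suc i) = bit-fromBits [] i
bit-fromBits (false ∷ v) zero    = cong (_≡ᵇ 1) (m*n%n≡0 (fromBits v) 2)
bit-fromBits (true ∷ v)  zero    = cong (_≡ᵇ 1) ([m+kn]%n≡m%n 1 (fromBits v) 2)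
bit-fromBits (false ∷ v) (suc i) =
  trans (cong (bit i) (m*n/n≡m (fromBits v) 2)) (bit-fromBits v i)
bit-fromBits (true ∷ v)  (suc i) =
  trans (cong (bit i) half) (bit-fromBits v i)
  where
  half : suc (fromBits v * 2) / 2 ≡ fromBits v
  half = trans (+-distrib-/ 1 (fromBits v * 2) no-carry) (m*n/n≡m (fromBits v) 2)
    where
    no-carry : 1 + fromBits v * 2 % 2 < 2
    no-carry = subst (λ m → 1 + m < 2) (sym (m*n%n≡0 (fromBits v) 2)) ≤-refl

fromBits<2^k : (v : Vec Bool k) → fromBits v < 2 ^ k
fromBits<2^k []          = s≤s z≤n
fromBits<2^k {suc k} (b ∷ v) = begin-strict
  fromBits (b ∷ v)     ≤⟨ lsb b ⟩
  suc (fromBits v * 2) <⟨ n<1+n _ ⟩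
  suc (fromBits v) * 2 ≤⟨ *-monoˡ-≤ 2 (fromBits<2^k v) ⟩
  2 ^ k * 2            ≡⟨ *-comm (2 ^ k) 2 ⟩
  2 ^ suc k            ∎
  where
  open ≤-Reasoning
  lsb : ∀ b → fromBits (b ∷ v) ≤ suc (fromBits v * 2)
  lsb false = n≤1+n _
  lsb true  = ≤-refl

fromBits≡0⇒zeros : (v : Vec Bool k) → fromBits v ≡ 0 → v ≡ replicate k false
fromBits≡0⇒zeros []          _ = refl
fromBits≡0⇒zeros (false ∷ v) e with m*n≡0⇒m≡0∨n≡0 (fromBits v) e
... | inj₁ e′ = cong (false ∷_) (fromBits≡0⇒zeros v e′)
fromBits≡0⇒zeros (true ∷ v)  ()

m<n⇒m∸1<n∸1 : ∀ {m n} → 1 < n → m < n → m ∸ 1 < n ∸ 1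
m<n⇒m∸1<n∸1 {zero}  {suc zero}    (s≤s ()) _
m<n⇒m∸1<n∸1 {zero}  {suc (suc n)} _ _         = s≤s z≤n
m<n⇒m∸1<n∸1 {suc m} {suc n}       _ (s≤s m<n) = m<n

-- Fin index p of a pattern of U_k stands for the position p + 1 read by Defs.bit.
position : Vec Bool (suc k) → Fin (2 ^ suc k ∸ 1)
position {k} v = fromℕ< (m<n⇒m∸1<n∸1 (*-monoʳ-≤ 2 (m^n>0 2 k)) (fromBits<2^k v))

suc-toℕ-position : (v : Vec Bool (suc k)) → v ≢ replicate (suc k) false →
                   suc (toℕ (position v)) ≡ fromBits v
suc-toℕ-position v v≢0 = trans (cong suc (toℕ-fromℕ< _)) (suc-∸1 (v≢0 ∘ fromBits≡0⇒zeros v))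
  where
  suc-∸1 : ∀ {m} → m ≢ 0 → suc (m ∸ 1) ≡ m
  suc-∸1 {zero}  m≢0 = ⊥-elim (m≢0 refl)
  suc-∸1 {suc m} _   = refl

unit : (k : ℕ) → ℕ → Vec Bool k
unit zero    _       = []
unit (suc k) zero    = true ∷ replicate k false
unit (suc k) (suc i) = false ∷ unit k i

bitAt-unit-≢ : ∀ k {i j} → j ≢ i → bitAt (unit k i) j ≡ false
bitAt-unit-≢ zero    {i}     {j}     _   = refl
bitAt-unit-≢ (suc k) {zero}  {zero}  j≢i = ⊥-elim (j≢i refl)
bitAt-unit-≢ (suc k) {zero}  {suc j} _   = bitAt-replicate k j
bitAt-unit-≢ (suc k) {suc i} {zero}  _   = refl
bitAt-unit-≢ (suc k) {suc i} {suc j} j≢i = bitAt-unit-≢ k (j≢i ∘ cong suc)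

unit≢zeros : ∀ {i} → i < k → unit k i ≢ replicate k false
unit≢zeros {suc k} {zero}  _         ()
unit≢zeros {suc k} {suc i} (s≤s i<k) eq = unit≢zeros i<k (cong tail eq)

IgnoresBit : ℕ → (Vec Bool k → A) → Set
IgnoresBit i h = ∀ v w → (∀ j → j ≢ i → bitAt v j ≡ bitAt w j) → h v ≡ h w

∘-ignoresBit : ∀ {i} (f : A → B) {h : Vec Bool k → A} → IgnoresBit i h → IgnoresBit i (f ∘ h)
∘-ignoresBit f h-ign v w agree = cong f (h-ign v w agree)

ignoresBit-unit : ∀ {i} {h : Vec Bool k → A} → IgnoresBit i h → h (unit k i) ≡ h (replicate k false)
ignoresBit-unit {k} h-ign = h-ign _ _ (λ j j≢i → trans (bitAt-unit-≢ k j≢i) (sym (bitAt-replicate k j)))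

-- Subsets and the patterns U_k^c

choose-map : (u : A → B) → ∀ c L → choose c (lmap u L) ≡ lmap (map u) (choose c L)
choose-map u zero    L        = refl
choose-map u (suc c) []       = refl
choose-map u (suc c) (a ∷ as) = begin
  lmap (u a ∷_) (choose c (lmap u as)) ++ choose (suc c) (lmap u as)
    ≡⟨ cong₂ _++_ (cong (lmap (u a ∷_)) (choose-map u c as)) (choose-map u (suc c) as) ⟩
  lmap (u a ∷_) (lmap (map u) (choose c as)) ++ lmap (map u) (choose (suc c) as)
    ≡⟨ cong (_++ _) (trans (sym (lmap-∘ (choose c as))) (lmap-∘ (choose c as))) ⟩
  lmap (map u) (lmap (a ∷_) (choose c as)) ++ lmap (map u) (choose (suc c) as)
    ≡⟨ map-++ (map u) (lmap (a ∷_) (choose c as)) (choose (suc c) as) ⟨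
  lmap (map u) (lmap (a ∷_) (choose c as) ++ choose (suc c) as) ∎
  where open ≡-Reasoning

choose-⊆ : ∀ c (L : List A) {I} → I ∈ choose c L → All (_∈ L) I
choose-⊆ zero    L        {[]} _   = []
choose-⊆ (suc c) (a ∷ as) I∈ with ∈-++⁻ (lmap (a ∷_) (choose c as)) I∈
... | inj₁ I∈₁ with ∈-map⁻ (a ∷_) I∈₁
...   | I , I∈ , refl = here refl ∷ All.map there (choose-⊆ c as I∈)
choose-⊆ (suc c) (a ∷ as) I∈ | inj₂ I∈₂ = All.map there (choose-⊆ (suc c) as I∈₂)

choose-misses : ∀ c {L : List A} {I} → Unique L → I ∈ choose c L → c < length L →
                ∃ λ a → a ∈ L × All (a ≢_) I
choose-misses zero {a ∷ as} {[]} _ _ _ = a , here refl , []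
choose-misses (suc c) {a ∷ as} (a∉as ∷ unique) I∈ (s≤s c<) with ∈-++⁻ (lmap (a ∷_) (choose c as)) I∈
... | inj₁ I∈₁ with ∈-map⁻ (a ∷_) I∈₁
...   | I , I∈ , refl with choose-misses c unique I∈ c<
...     | b , b∈ , b∉I = b , there b∈ , ≢-sym (List.lookup a∉as b∈) ∷ b∉I
choose-misses (suc c) {a ∷ as} (a∉as ∷ _) I∈ _ | inj₂ I∈₂ =
  a , here refl , All.map (List.lookup a∉as) (choose-⊆ (suc c) as I∈₂)

lookup-transpose : (M : Vec (Vec A n) c) (q : Fin n) →
                   lookup (transpose M) q ≡ map (λ row → lookup row q) M
lookup-transpose {n = n} []    q = lookup-replicate q []
lookup-transpose {A = A} {n = n} {c = suc c} (a ∷ M) q = begin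
  lookup (replicate n cons ⊛ a ⊛ transpose M) q
    ≡⟨ lookup-⊛ q (replicate n cons ⊛ a) (transpose M) ⟩
  lookup (replicate n cons ⊛ a) q (lookup (transpose M) q)
    ≡⟨ cong (λ h → h (lookup (transpose M) q)) (lookup-⊛ q (replicate n cons) a) ⟩
  lookup (replicate n cons) q (lookup a q) (lookup (transpose M) q)
    ≡⟨ cong (λ h → h (lookup a q) (lookup (transpose M) q)) (lookup-replicate q cons) ⟩
  lookup a q ∷ lookup (transpose M) q
    ≡⟨ cong (lookup a q ∷_) (lookup-transpose M q) ⟩
  lookup a q ∷ map (λ row → lookup row q) M ∎
  where
  open ≡-Reasoning
  cons : A → Vec A c → Vec A (suc c)
  cons = _∷_

column : Vec (Vec A n) c → Fin n → Vec A c
column ts j = map (λ t → lookup t j) ts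

tabulate-column : ∀ (f : A → B) (ts : Vec (Vec A n) c) q →
                  tabulate (λ j → f (lookup (column ts j) q)) ≡ map f (lookup ts q)
tabulate-column f ts q = begin
  tabulate (λ j → f (lookup (column ts j) q))
    ≡⟨ tabulate-cong (λ j → cong f (lookup-map q (λ t → lookup t j) ts)) ⟩
  tabulate (f ∘ lookup (lookup ts q))         ≡⟨ tabulate-∘ f _ ⟩
  map f (tabulate (lookup (lookup ts q)))     ≡⟨ cong (map f) (tabulate∘lookup _) ⟩
  map f (lookup ts q)                         ∎
  where open ≡-Reasoning

decXY : DecidableEquality XY
decXY x x = yes refl
decXY x y = no λ ()
decXY y x = no λ ()
decXY y y = yes refl

bitVar : Bool → XY
bitVar b = if b then x else y

U-pair : ℕ → Vec XY n × XY
U-pair i = tabulate (λ p → bitVar (bit i (suc (toℕ p)))) , y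

row : Vec ℕ c → Vec Bool k → Vec XY c
row I v = map (bitVar ∘ bitAt v) I

row-ignoresBit : ∀ {i} {I : Vec ℕ c} → All (i ≢_) I → IgnoresBit {k = k} i (row I)
row-ignoresBit []            v w agree = refl
row-ignoresBit (i≢j ∷ i∉I) v w agree =
  cong₂ _∷_ (cong bitVar (agree _ (≢-sym i≢j))) (row-ignoresBit i∉I v w agree)

record HasFreeBit {V : Set} (k : ℕ) (pp : Vec V (2 ^ suc k ∸ 1) × V) : Set where
  field
    free           : ℕ
    free<k         : free < suc k
    entry          : Vec Bool (suc k) → V
    entry-ignores  : IgnoresBit free entry
    entry-position : ∀ v → v ≢ replicate (suc k) false → lookup (proj₁ pp) (position v) ≡ entry v
    entry-origin   : entry (replicate (suc k) false) ≡ proj₂ pp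

target∈entries : ∀ {pp : Vec V (2 ^ suc k ∸ 1) × V} → HasFreeBit k pp → proj₂ pp Vec.∈ proj₁ pp
target∈entries {k = k} {pp} H =
  subst (Vec._∈ proj₁ pp) entry-unit (∈-lookup (position (unit (suc k) free)) (proj₁ pp))
  where
  open HasFreeBit H
  entry-unit : lookup (proj₁ pp) (position (unit (suc k) free)) ≡ proj₂ pp
  entry-unit = trans (entry-position _ (unit≢zeros free<k))
                     (trans (ignoresBit-unit entry-ignores) entry-origin)

power-U-hasFreeBit : c < suc k → ∀ {pp} → pp ∈ power c (U (suc k)) → HasFreeBit k pp
power-U-hasFreeBit {c} {k} c<k pp∈ with ∈-map⁻ _ pp∈
... | S , S∈ , refl with ∈-map⁻ (map U-pair) (subst (S ∈_) (choose-map U-pair c (upTo (suc k))) S∈)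
... | I , I∈ , refl with choose-misses c (upTo⁺ (suc k)) I∈ (subst (c <_) (sym (length-upTo (suc k))) c<k)
... | i , i∈ , i∉I = record
  { free           = i
  ; free<k         = ∈-upTo⁻ i∈
  ; entry          = row I
  ; entry-ignores  = row-ignoresBit i∉I
  ; entry-position = columns
  ; entry-origin   = origin
  }
  where
  columns : ∀ v → v ≢ replicate (suc k) false →
            lookup (transpose (map proj₁ (map U-pair I))) (position v) ≡ row I v
  columns v v≢0 = begin
    lookup (transpose (map proj₁ (map U-pair I))) (position v)
      ≡⟨ lookup-transpose _ (position v) ⟩
    map (λ row → lookup row (position v)) (map proj₁ (map U-pair I))
      ≡⟨ sym (trans (map-∘ _ _ I) (map-∘ _ _ (map U-pair I))) ⟩
    map (λ i → lookup (proj₁ (U-pair i)) (position v)) I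
      ≡⟨ map-cong (λ i → trans (lookup∘tabulate _ (position v))
           (cong bitVar (trans (cong (bit i) (suc-toℕ-position v v≢0)) (bit-fromBits v i)))) I ⟩
    row I v ∎
    where open ≡-Reasoning
  origin : row I (replicate (suc k) false) ≡ map proj₂ (map U-pair I)
  origin = trans (map-cong (λ i → cong bitVar (bitAt-replicate (suc k) i)) I) (map-∘ proj₂ U-pair I)

-- Decidability of pattern domains

module _ {D : Set} (_≟D_ : DecidableEquality D) (_≟V_ : DecidableEquality V) where

  Consistent : Vec V n → Vec D n → Set
  Consistent X t = ∀ p q → lookup X p ≡ lookup X q → lookup t p ≡ lookup t q

  consistent? : (X : Vec V n) (t : Vec D n) → Dec (Consistent X t)
  consistent? X t = all? λ p → all? λ q → lookup X p ≟V lookup X q →-dec lookup t p ≟D lookup t q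

  map-consistent : ∀ (g : V → D) (X : Vec V n) → Consistent X (map g X)
  map-consistent g X p q Xp≡Xq = begin
    lookup (map g X) p ≡⟨ lookup-map p g X ⟩
    g (lookup X p)     ≡⟨ cong g Xp≡Xq ⟩
    g (lookup X q)     ≡⟨ lookup-map q g X ⟨
    lookup (map g X) q ∎
    where open ≡-Reasoning

  -- d is the value at the variables not occurring in X
  extend : D → Vec V n → Vec D n → V → D
  extend d []      []      v = d
  extend d (a ∷ X) (b ∷ t) v with a ≟V v
  ... | yes _ = b
  ... | no  _ = extend d X t v

  extend-lookup : ∀ d (X : Vec V n) t → Consistent X t → ∀ p → extend d X t (lookup X p) ≡ lookup t p
  extend-lookup d (a ∷ X) (b ∷ t) cons fzero with a ≟V a
  ... | yes _   = refl
  ... | no  a≢a = ⊥-elim (a≢a refl)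
  extend-lookup d (a ∷ X) (b ∷ t) cons (fsuc p) with a ≟V lookup X p
  ... | yes a≡Xp = cons fzero (fsuc p) a≡Xp
  ... | no  _    = extend-lookup d X t (λ p q → cons (fsuc p) (fsuc q)) p

  ∃-map? : D → (X : Vec V n) (t : Vec D n) → Dec (∃ λ g → map g X ≡ t)
  ∃-map? d X t with consistent? X t
  ... | yes cons = yes (extend d X t , Pointwise-≡⇒≡ (ext λ p →
                        trans (lookup-map p _ X) (extend-lookup d X t cons p)))
  ... | no ¬cons = no λ { (g , refl) → ¬cons (map-consistent g X) }

  inPatternDom? : ∀ {P : Pattern n V} → D → Decidable (InPatternDom {D} P)
  inPatternDom? {P = P} d t =
    map′ find (λ { (p , p∈ , G) → lose p∈ G }) (any? (λ p → ∃-map? d (proj₁ p) t) P)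

-- A Mal'tsev term on the cube

module MaltsevCube {E : Set} (φ : E → E → E → E)
                   (φ-left : ∀ a b → φ a a b ≡ b) (φ-right : ∀ a b → φ b a a ≡ b) where

  cong-φ : ∀ {a a′ b b′ d d′} → a ≡ a′ → b ≡ b′ → d ≡ d′ → φ a b d ≡ φ a′ b′ d′
  cong-φ refl refl refl = refl

  combine : ∀ k → (Vec Bool (suc k) → E) → E
  combine zero    h = h (true ∷ [])
  combine (suc k) h = φ (combine k (h ∘ (false ∷_))) (combine k (h ∘ (true ∷_)))
                        (h (true ∷ replicate (suc k) false))

  combine-cong : ∀ k {h h′ : Vec Bool (suc k) → E} →
                 (∀ v → v ≢ replicate (suc k) false → h v ≡ h′ v) → combine k h ≡ combine k h′
  combine-cong zero    h≡h′ = h≡h′ (true ∷ []) (λ ())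
  combine-cong (suc k) h≡h′ =
    cong-φ (combine-cong k (λ v v≢0 → h≡h′ (false ∷ v) (v≢0 ∘ cong tail)))
            (combine-cong k (λ v _ → h≡h′ (true ∷ v) (λ ())))
            (h≡h′ _ (λ ()))

  -- If h ignores the first bit, the first two arguments of φ agree (φ-left); otherwise
  -- by induction they are h(0) and the third argument (φ-right).
  combine-ignoresBit : ∀ k {i} {h : Vec Bool (suc k) → E} → i < suc k → IgnoresBit i h →
                       combine k h ≡ h (replicate (suc k) false)
  combine-ignoresBit zero    {zero} _ h-ign = h-ign _ _ agree-off-0
    where
    agree-off-0 : ∀ j → j ≢ 0 → bitAt (true ∷ []) j ≡ bitAt (false ∷ []) j
    agree-off-0 zero    j≢0 = ⊥-elim (j≢0 refl)
    agree-off-0 (suc j) _   = refl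
  combine-ignoresBit zero    {suc i} (s≤s ()) _
  combine-ignoresBit (suc k) {zero} {h} _ h-ign = begin
    φ (combine k (h ∘ (false ∷_))) (combine k (h ∘ (true ∷_))) (h (true ∷ zeros))
      ≡⟨ cong-φ (combine-cong k (λ v _ → flip-first v)) refl refl ⟩
    φ (combine k (h ∘ (true ∷_))) (combine k (h ∘ (true ∷_))) (h (true ∷ zeros))
      ≡⟨ φ-left _ _ ⟩
    h (true ∷ zeros)
      ≡⟨ sym (flip-first zeros) ⟩
    h (false ∷ zeros) ∎
    where
    open ≡-Reasoning
    zeros = replicate (suc k) false
    flip-first : ∀ v → h (false ∷ v) ≡ h (true ∷ v)
    flip-first v = h-ign _ _ λ { zero j≢0 → ⊥-elim (j≢0 refl) ; (suc j) _ → refl }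
  combine-ignoresBit (suc k) {suc i} {h} (s≤s i<k) h-ign =
    trans (cong-φ (combine-ignoresBit k i<k (tail-ignores false))
                  (combine-ignoresBit k i<k (tail-ignores true)) refl)
          (φ-right _ _)
    where
    tail-ignores : ∀ b → IgnoresBit i (h ∘ (b ∷_))
    tail-ignores b v w agree = h-ign _ _ λ { zero _ → refl ; (suc j) j≢i → agree j (j≢i ∘ cong suc) }

  combine-preserves : ∀ {r} (Q : Vec E r → Set) →
    (∀ a b d → Q a → Q b → Q d → Q (tabulate λ j → φ (lookup a j) (lookup b j) (lookup d j))) →
    ∀ k (M : Vec Bool (suc k) → Fin r → E) → (∀ v → Q (tabulate (M v))) →
    Q (tabulate λ j → combine k (λ v → M v j))
  combine-preserves Q φ-pres zero    M Q-M = Q-M (true ∷ [])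
  combine-preserves Q φ-pres (suc k) M Q-M =
    subst Q (tabulate-cong λ j →
               cong-φ (lookup∘tabulate _ j) (lookup∘tabulate _ j) (lookup∘tabulate _ j))
      (φ-pres _ _ _ (combine-preserves Q φ-pres k (M ∘ (false ∷_)) (Q-M ∘ (false ∷_)))
                    (combine-preserves Q φ-pres k (M ∘ (true ∷_)) (Q-M ∘ (true ∷_)))
                    (Q-M _))

  combine-column : ∀ {D V : Set} {k} {pp : Vec V (2 ^ suc k ∸ 1) × V} → HasFreeBit k pp →
                   (g : V → D) {t : Vec D (2 ^ suc k ∸ 1)} → map g (proj₁ pp) ≡ t → (e : D → E) →
                   combine k (λ v → e (lookup t (position v))) ≡ e (g (proj₂ pp))
  combine-column {k = k} {pp = X , z} H g refl e = begin
    combine k (λ v → e (lookup (map g X) (position v)))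
      ≡⟨ combine-cong k (λ v v≢0 → cong e (trans (lookup-map _ g X) (cong g (entry-position v v≢0)))) ⟩
    combine k (e ∘ g ∘ entry)
      ≡⟨ combine-ignoresBit k free<k (∘-ignoresBit (e ∘ g) entry-ignores) ⟩
    e (g (entry (replicate (suc k) false)))
      ≡⟨ cong (e ∘ g) entry-origin ⟩
    e (g z) ∎
    where
    open ≡-Reasoning
    open HasFreeBit H

  -- Since f t is defined, t is not outside the pattern domain; decidability turns
  -- this double negation into a pair of P and a g.
  combine-defined : ∀ {D V : Set} {k} {P : Pattern (2 ^ suc k ∸ 1) V}
                    {f : PartialFun D (2 ^ suc k ∸ 1)} → InI P f →
                    (∀ {pp} → pp ∈ P → HasFreeBit k pp) → (D → Decidable (InPatternDom {D} P)) →
                    ∀ {t d} → f t ≡ just d → (e : D → E) →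
                    combine k (λ v → e (lookup t (position v))) ≡ e d
  combine-defined {f = f} (_ , undefined , on-pattern) hasFreeBit dom? {t} {d} ft≡d e
    with decidable-stable (dom? d t) (λ ¬dom → just≢nothing (trans (sym ft≡d) (undefined t ¬dom)))
    where
    just≢nothing : just d ≢ nothing
    just≢nothing ()
  ... | pp , pp∈ , g , g≡t = trans (combine-column (hasFreeBit pp∈) g g≡t e) (cong e value)
    where
    value : g (proj₂ pp) ≡ d
    value = just-injective (begin
      just (g (proj₂ pp))  ≡⟨ on-pattern pp pp∈ g (target∈entries (hasFreeBit pp∈)) ⟨
      f (map g (proj₁ pp)) ≡⟨ cong f g≡t ⟩
      f t                  ≡⟨ ft≡d ⟩
      just d               ∎)
      where open ≡-Reasoning

lemma7p22 : (D : Set) → IsFinite D → (r : ℕ) → (R : Vec D r → Set) →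
    MaltsevEmbedding R →
    (k : ℕ) → 2 ≤ k → (f : PartialFun D (2 ^ k ∸ 1)) →
    InI (power (k ∸ 1) (U k)) f → IsPartialPolymorphism R f
lemma7p22 D (_ , Fin↔D) r R emb (suc (suc m)) (s≤s (s≤s z≤n)) f f∈I ts ts∈R vals f≡vals =
  Equivalence.to (Q∩σD vals)
    (subst Q combined≡σvals (combine-preserves Q φ-pres (suc m) _ columns∈Q))
  where
  open MaltsevEmbedding emb
  open MaltsevCube φ φ-left φ-right

  dom? : D → Decidable (InPatternDom {D} (power (suc m) (U (suc (suc m)))))
  dom? = inPatternDom? (inj⇒≟ (↔⇒↣ (↔-sym Fin↔D))) (≡-dec decXY)

  columns∈Q : ∀ v → Q (tabulate λ j → σ (lookup (column ts j) (position v)))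
  columns∈Q v = subst Q (sym (tabulate-column σ ts (position v)))
                        (Equivalence.from (Q∩σD _) (lookup⁺ ts∈R (position v)))

  combined≡σvals : tabulate (λ j → combine (suc m) (λ v → σ (lookup (column ts j) (position v))))
                   ≡ map σ vals
  combined≡σvals = Pointwise-≡⇒≡ (ext λ j → begin
    lookup (tabulate _) j
      ≡⟨ lookup∘tabulate _ j ⟩
    combine (suc m) (λ v → σ (lookup (column ts j) (position v)))
      ≡⟨ combine-defined f∈I (power-U-hasFreeBit (n<1+n (suc m))) dom? (f≡vals j) σ ⟩
    σ (lookup vals j)
      ≡⟨ lookup-map j σ vals ⟨
    lookup (map σ vals) j ∎)
    where open ≡-Reasoning
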